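{- For every Boolean function $f:\{0,1\}^n\to\{0,1\}$, $$\mathrm{C}_{\min}(f)\le \mathrm{Rank}(f)\le (\mathrm{C}_0(f)-1)(\mathrm{C}_1(f)-1)+1\le (\mathrm{C}(f)-1)^2+1.$$
   Context: A decision tree for $f$ is a rooted binary tree with internal nodes labelled by variables and leaves labelled $0/1$ that computes $f$. The rank of a rooted binary tree: leaves have rank $0$; an internal node with children of ranks $a,b$ has rank $a+1$ if $a=b$, else $\max\{a,b\}$. $\mathrm{Rank}(f)$ is the minimum rank of a decision tree computing $f$. For $a\in\{0,1\}^n$, $\mathrm{C}(f,a)$ is the minimum size of a set $S\subseteq[n]$ such that every $a'$ agreeing with $a$ on $S$ satisfies $f(a')=f(a)$. $\mathrm{C}_b(f)=\max\{\mathrm{C}(f,a): a\in f^{ -1}(b)\}$ (taken as $0$ if $f^{ -1}(b)$ is empty), $\mathrm{C}(f)=\max\{\mathrm{C}_0(f),\mathrm{C}_1(f)\}$, and $\mathrm{C}_{\min}(f)=\min_{a\in\{0,1\}^n}\mathrm{C}(f,a)$. -}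

module Defs where

open import Data.Bool using (Bool; true; false; _∧_; _∨_; not; if_then_else_)
open import Data.Bool.Properties using () renaming (_≟_ to _≟ᴮ_)
open import Data.Nat using (ℕ; zero; suc; _⊔_; _⊓_; _≤_)
open import Data.Fin using (Fin)
open import Data.Vec using (Vec; []; _∷_; lookup)
open import Data.List using (List; []; _∷_; map; foldr; filter; concatMap; allFin)
open import Data.Fin.Subset using (Subset; ∣_∣)
open import Relation.Nullary.Decidable using (does)
open import Relation.Binary.PropositionalEquality using (_≡_)
open import Data.Product using (Σ; ∃; _×_)

-- Inputs x ∈ {0,1}^n are vectors of booleans (false = 0, true = 1).
Input : ℕ → Set
Input n = Vec Bool n

BoolFun : ℕ → Set
BoolFun n = Input n → Bool

data DTree (n : ℕ) : Set where
  leaf : Bool → DTree n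
  node : Fin n → DTree n → DTree n → DTree n

eval : ∀ {n} → DTree n → Input n → Bool
eval (leaf b) x = b
eval (node i t₀ t₁) x = if lookup x i then eval t₁ x else eval t₀ x

Computes : ∀ {n} → DTree n → BoolFun n → Set
Computes t f = ∀ x → eval t x ≡ f x

rank : ∀ {n} → DTree n → ℕ
rank (leaf _) = 0
rank (node _ t₀ t₁) with rank t₀ | rank t₁
... | a | b = if does (Data.Nat._≟_ a b) then suc a else a ⊔ b

IsRank : ∀ {n} → BoolFun n → ℕ → Set
IsRank {n} f r =
  (Σ (DTree n) λ t → Computes t f × rank t ≡ r) ×
  (∀ (t : DTree n) → Computes t f → r ≤ rank t)

allVecs : ∀ n → List (Vec Bool n)
allVecs zero = [] ∷ []
allVecs (suc n) = concatMap (λ v → (false ∷ v) ∷ (true ∷ v) ∷ []) (allVecs n)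

allB : ∀ {A : Set} → (A → Bool) → List A → Bool
allB p [] = true
allB p (x ∷ xs) = p x ∧ allB p xs

agreeOn : ∀ {n} → Subset n → Input n → Input n → Bool
agreeOn [] [] [] = true
agreeOn (s ∷ S) (x ∷ a) (y ∷ a') =
  (not s ∨ does (x ≟ᴮ y)) ∧ agreeOn S a a'

isCertificate : ∀ {n} → BoolFun n → Input n → Subset n → Bool
isCertificate {n} f a S =
  allB (λ a' → not (agreeOn S a a') ∨ does (f a' ≟ᴮ f a)) (allVecs n)

-- C(f,a) = minimum size of a certificate for f at a
-- (the full set [n], of size n, is always a certificate, so n is a valid
--  initial value of the minimum)
Cat : ∀ {n} → BoolFun n → Input n → ℕ
Cat {n} f a =
  foldr _⊓_ n (map ∣_∣ (filter (λ S → isCertificate f a S ≟ᴮ true) (allVecs n)))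

-- C_b(f) = max over a ∈ f⁻¹(b) of C(f,a); 0 if f⁻¹(b) is empty
Cb : ∀ {n} → BoolFun n → Bool → ℕ
Cb {n} f b = foldr _⊔_ 0 (map (Cat f) (filter (λ a → f a ≟ᴮ b) (allVecs n)))

C₀ C₁ C : ∀ {n} → BoolFun n → ℕ
C₀ f = Cb f false
C₁ f = Cb f true
C f = C₀ f ⊔ C₁ f

-- C_min(f) = min over all a of C(f,a)  (each C(f,a) ≤ n)
Cmin : ∀ {n} → BoolFun n → ℕ
Cmin {n} f = foldr _⊓_ n (map (Cat f) (allVecs n))

{-# OPTIONS --safe #-}
-- Lower bound: walk down a tree of rank r, at each new variable entering a child of smaller
-- rank and at an already queried variable the child forced by the earlier answer. At most r
-- variables get fixed, and fixing them fixes the value of the tree: a certificate of size ≤ r.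
--
-- Upper bound: take a b-input a with a b-certificate S, |S| ≤ C_b, and query all of S. On the
-- branch that answers like a the function is constant b. Every (not b)-certificate meets S
-- (otherwise a and the certified input could be combined into one input satisfying both), so on
-- every other branch the restricted function has (not b)-certificates one smaller. The rank-0 leaf
-- on the branch of a makes the query tree cost only |S| - 1 above its subtrees. For the largest
-- rank R(k, m) of a function with C₀ ≤ k and C₁ ≤ m this gives R(k, m) ≤ (m - 1) + R(k - 1, m)
-- when b = 1, and R(1, m) ≤ 1 when b = 0.
module Submission where

open import Defs
open import Data.Nat using (ℕ; _≤_; _∸_; _*_; _+_; _^_)
open import Data.Product using (_×_)

open import Data.Bool using (Bool; true; false; not; _∧_; _∨_; if_then_else_)
open import Data.Bool.Properties using (¬-not; not-¬; ∧-conicalˡ; ∧-conicalʳ) renaming (_≟_ to _≟ᴮ_)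
open import Data.Empty using (⊥-elim)
open import Data.Fin using (Fin) renaming (_≟_ to _≟ᶠ_)
open import Data.Fin.Properties using (all?; any?)
open import Data.Fin.Subset using (Subset; ∣_∣; inside; _∈_; _∉_; _-_) renaming (⊤ to full; ⊥ to empty)
open import Data.Fin.Subset.Properties using (_∈?_; ∈⊤; ∉⊥; ∣⊤∣≡n; ∣⊥∣≡0; x∈p⇒∣p-x∣<∣p∣; x∈p∧x≢y⇒x∈p-y)
open import Data.List using (List; []; _∷_; map; foldr; length)
open import Data.List.Properties using (length-map; foldr-preservesᵇ; foldr-preservesᵒ)
open import Data.List.Membership.Propositional using () renaming (_∈_ to _∈ₗ_)
open import Data.List.Membership.Propositional.Properties using (∈-map⁺; ∈-filter⁺; ∈-concat⁺′)
open import Data.List.Relation.Unary.All as All using ()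
open import Data.List.Relation.Unary.All.Properties using (all-filter) renaming (map⁺ to All-map⁺)
open import Data.List.Relation.Unary.Any as Any using () renaming (here to hereₗ; there to thereₗ)
open import Data.Nat as ℕ using (zero; suc; _<_; _⊓_; _⊔_; z≤n; s≤s)
open import Data.Nat.Properties
open import Data.Product using (Σ-syntax; ∃; _,_; proj₁; proj₂)
open import Data.Sum using (_⊎_; inj₁; inj₂; [_,_])
open import Data.Vec using ([]; _∷_; lookup; replicate; _[_]≔_; here; there)
open import Data.Vec.Properties using (tabulate∘lookup; tabulate-cong; lookup∘update; lookup∘update′; []≔-updates; []≔-minimal; []=⇒lookup; lookup⇒[]=)
open import Function using (_∘_)
open import Relation.Nullary using (Dec; yes; no; does; contradiction)
open import Relation.Nullary.Decidable using (map′; dec-true; dec-false; _→-dec_; _×-dec_)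
open import Relation.Unary using (Decidable)
open import Relation.Binary.Definitions using (tri<; tri≈; tri>)
open import Relation.Binary.PropositionalEquality using (_≡_; _≢_; refl; sym; trans; cong; cong₂; subst; module ≡-Reasoning)

private
  variable
    n : ℕ

lookup-ext : {a b : Input n} → (∀ j → lookup a j ≡ lookup b j) → a ≡ b
lookup-ext {a = a} {b} h = trans (sym (tabulate∘lookup a)) (trans (tabulate-cong h) (tabulate∘lookup b))

∈-allVecs : (a : Input n) → a ∈ₗ allVecs n
∈-allVecs [] = hereₗ refl
∈-allVecs (false ∷ a) = ∈-concat⁺′ (hereₗ refl) (∈-map⁺ _ (∈-allVecs a))
∈-allVecs (true ∷ a) = ∈-concat⁺′ (thereₗ (hereₗ refl)) (∈-map⁺ _ (∈-allVecs a))

∃-input? : {P : Input n → Set} → Decidable P → Dec (∃ P)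
∃-input? {n} P? = map′ Any.satisfied (λ (a , pa) → Any.map (λ { refl → pa }) (∈-allVecs a)) (Any.any? P? (allVecs n))

Agree : Subset n → Input n → Input n → Set
Agree S a b = ∀ j → j ∈ S → lookup a j ≡ lookup b j

Agree? : (S : Subset n) (a b : Input n) → Dec (Agree S a b)
Agree? S a b = all? (λ j → (j ∈? S) →-dec (lookup a j ≟ᴮ lookup b j))

Agree-full⇒≡ : {a b : Input n} → Agree full a b → a ≡ b
Agree-full⇒≡ ag = lookup-ext (λ j → ag j ∈⊤)

∣S∣≤0⇒Agree : {S : Subset n} {a b : Input n} → ∣ S ∣ ≤ 0 → Agree S a b
∣S∣≤0⇒Agree ∣S∣≤0 j j∈S = ⊥-elim (n≮0 (<-≤-trans (x∈p⇒∣p-x∣<∣p∣ j∈S) ∣S∣≤0))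

insert : Fin n → Subset n → Subset n
insert i S = S [ i ]≔ inside

∣insert∣≤ : (i : Fin n) (S : Subset n) → ∣ insert i S ∣ ≤ suc ∣ S ∣
∣insert∣≤ Fin.zero (true ∷ S) = n≤1+n _
∣insert∣≤ Fin.zero (false ∷ S) = ≤-refl
∣insert∣≤ (Fin.suc i) (true ∷ S) = s≤s (∣insert∣≤ i S)
∣insert∣≤ (Fin.suc i) (false ∷ S) = ∣insert∣≤ i S

Agree-insert⁺ : ∀ {i} {S : Subset n} a b → lookup a i ≡ lookup b i → Agree S a b → Agree (insert i S) a b
Agree-insert⁺ {i = i} {S} a b aᵢ≡bᵢ ag j j∈ with j ≟ᶠ i
... | yes refl = aᵢ≡bᵢ
... | no j≢i = ag j (lookup⇒[]= j S (trans (sym (lookup∘update′ j≢i S inside)) ([]=⇒lookup j∈)))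

Agree-insert⁻ : ∀ {i} {S : Subset n} a b → Agree (insert i S) a b → lookup a i ≡ lookup b i × Agree S a b
Agree-insert⁻ {i = i} {S} a b ag = ag i ([]≔-updates S i) , λ j j∈S → ag j (∈-insert j∈S)
  where
  ∈-insert : ∀ {j} → j ∈ S → j ∈ insert i S
  ∈-insert {j} j∈S with j ≟ᶠ i
  ... | yes refl = []≔-updates S i
  ... | no j≢i = []≔-minimal S j i j≢i j∈S

Certificate : BoolFun n → Input n → Subset n → Set
Certificate f a S = ∀ x → Agree S a x → f x ≡ f a

CertificateBound : BoolFun n → Bool → ℕ → Set
CertificateBound {n} f b k = ∀ a → f a ≡ b → Σ[ S ∈ Subset n ] Certificate f a S × ∣ S ∣ ≤ k

RankBound : BoolFun n → ℕ → Set
RankBound {n} f r = Σ[ t ∈ DTree n ] Computes t f × rank t ≤ r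

CertificateBound-zero⇒≡ : ∀ {f : BoolFun n} {a b} → CertificateBound f b 0 → f a ≡ b → ∀ x → f x ≡ b
CertificateBound-zero⇒≡ {a = a} cb fa≡b x with cb a fa≡b
... | S , cert , ∣S∣≤0 = trans (cert x (∣S∣≤0⇒Agree {a = a} {x} ∣S∣≤0)) fa≡b

CertificateBound-zero⇒constant : ∀ {f : BoolFun n} {b} → CertificateBound f b 0 → ∀ x y → f x ≡ f y
CertificateBound-zero⇒constant {f = f} {b} cb x y with f x ≟ᴮ b | f y ≟ᴮ b
... | yes fx≡b | _ = trans fx≡b (sym (CertificateBound-zero⇒≡ cb fx≡b y))
... | no _ | yes fy≡b = trans (CertificateBound-zero⇒≡ cb fy≡b x) (sym fy≡b)
... | no fx≢b | no fy≢b = trans (¬-not fx≢b) (sym (¬-not fy≢b))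

CertificateBound-zero⇒RankBound : ∀ {f : BoolFun n} {b} r → CertificateBound f b 0 → RankBound f r
CertificateBound-zero⇒RankBound {n} {f} _ cb =
  leaf (f (replicate n false)) , CertificateBound-zero⇒constant cb (replicate n false) , z≤n

merge : Subset n → Input n → Input n → Input n
merge [] [] [] = []
merge (s ∷ S) (w ∷ ws) (x ∷ xs) = (if s then w else x) ∷ merge S ws xs

lookup-merge-∈ : ∀ {S : Subset n} w x {j} → j ∈ S → lookup (merge S w x) j ≡ lookup w j
lookup-merge-∈ (w ∷ ws) (x ∷ xs) here = refl
lookup-merge-∈ (w ∷ ws) (x ∷ xs) (there j∈S) = lookup-merge-∈ ws xs j∈S

lookup-merge-∉ : ∀ (S : Subset n) w x {j} → j ∉ S → lookup (merge S w x) j ≡ lookup x j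
lookup-merge-∉ (true ∷ S) (w ∷ ws) (x ∷ xs) {Fin.zero} j∉S = contradiction here j∉S
lookup-merge-∉ (false ∷ S) (w ∷ ws) (x ∷ xs) {Fin.zero} j∉S = refl
lookup-merge-∉ (s ∷ S) (w ∷ ws) (x ∷ xs) {Fin.suc j} j∉S = lookup-merge-∉ S ws xs (j∉S ∘ there)

Agree-merge : ∀ (S : Subset n) w x → Agree S w (merge S w x)
Agree-merge S w x j j∈S = sym (lookup-merge-∈ w x j∈S)

merge-identity : ∀ {S : Subset n} {w x} → Agree S w x → merge S w x ≡ x
merge-identity {S = S} {w} {x} ag = lookup-ext λ j → byMembership (j ∈? S)
  where
  byMembership : ∀ {j} → Dec (j ∈ S) → lookup (merge S w x) j ≡ lookup x j
  byMembership (yes j∈S) = trans (lookup-merge-∈ w x j∈S) (ag _ j∈S)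
  byMembership (no j∉S) = lookup-merge-∉ S w x j∉S

merge-preserves-Agree : ∀ {S T : Subset n} {w x y} → (∀ j → j ∈ T → j ∉ S → lookup x j ≡ lookup y j) →
                        Agree T (merge S w x) (merge S w y)
merge-preserves-Agree {S = S} {T} {w} {x} {y} ag j j∈T with j ∈? S
... | yes j∈S = trans (lookup-merge-∈ w x j∈S) (sym (lookup-merge-∈ w y j∈S))
... | no j∉S = trans (lookup-merge-∉ S w x j∉S) (trans (ag j j∈T j∉S) (sym (lookup-merge-∉ S w y j∉S)))

certificates-meet : ∀ {f : BoolFun n} {a x S T} → Certificate f a S → Certificate f x T → f a ≢ f x →
                    ∃ λ q → q ∈ T × q ∈ S
certificates-meet {f = f} {a} {x} {S} {T} certS certT fa≢fx with any? (λ q → (q ∈? T) ×-dec (q ∈? S))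
... | yes meet = meet
... | no disjoint = contradiction (trans (sym (certS y (Agree-merge S a x))) (certT y agreeT)) fa≢fx
  where
  y = merge S a x
  agreeT : Agree T x y
  agreeT j j∈T with j ∈? S
  ... | yes j∈S = contradiction (j , j∈T , j∈S) disjoint
  ... | no j∉S = sym (lookup-merge-∉ S a x j∉S)

restrict : Subset n → Input n → BoolFun n → BoolFun n
restrict S w f x = f (merge S w x)

restrict-certificate : ∀ {S : Subset n} {w} {f : BoolFun n} {x T T′} → Certificate f (merge S w x) T →
                       (∀ j → j ∈ T → j ∉ S → j ∈ T′) → Certificate (restrict S w f) x T′
restrict-certificate cert T∖S⊆T′ y ag = cert _ (merge-preserves-Agree (λ j j∈T j∉S → ag j (T∖S⊆T′ j j∈T j∉S)))

restrict-preserves : ∀ {S : Subset n} {w} {f : BoolFun n} {b k} → CertificateBound f b k → CertificateBound (restrict S w f) b k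
restrict-preserves {S = S} {w} cb x fx≡b with cb (merge S w x) fx≡b
... | T , cert , ∣T∣≤k = T , restrict-certificate cert (λ j j∈T _ → j∈T) , ∣T∣≤k

-- A (not b)-certificate meets the b-certificate S, and coordinates in S are fixed by the restriction.
restrict-shrinks : ∀ {S : Subset n} {w} {f : BoolFun n} {a b k} → f a ≡ b → Certificate f a S →
                   CertificateBound f (not b) (suc k) → CertificateBound (restrict S w f) (not b) k
restrict-shrinks {S = S} {w} {f} {a} {b} fa≡b certS cb x fx≡¬b with cb (merge S w x) fx≡¬b
... | T , certT , ∣T∣≤1+k with certificates-meet certS certT (λ fa≡fx → not-¬ fa≡b (trans fa≡fx fx≡¬b))
... | q , q∈T , q∈S =
  T - q , restrict-certificate certT (λ j j∈T j∉S → x∈p∧x≢y⇒x∈p-y j∈T (λ { refl → j∉S q∈S })) ,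
  ≤-pred (≤-trans (x∈p⇒∣p-x∣<∣p∣ q∈T) ∣T∣≤1+k)

restrict-constant : ∀ {S : Subset n} {w} {f : BoolFun n} {a} → Certificate f a S → Agree S w a → ∀ x → restrict S w f x ≡ f a
restrict-constant {S = S} {w} {a = a} cert w≈a x =
  cert _ (λ j j∈S → trans (sym (w≈a j j∈S)) (sym (lookup-merge-∈ w x j∈S)))

nodeRank : ℕ → ℕ → ℕ
nodeRank a b = if does (a ℕ.≟ b) then suc a else a ⊔ b

nodeRank-≡ : ∀ {a b} → a ≡ b → nodeRank a b ≡ suc a
nodeRank-≡ {a} refl = cong (λ c → if c then suc a else a ⊔ a) (dec-true (a ℕ.≟ a) refl)

nodeRank-≢ : ∀ {a b} → a ≢ b → nodeRank a b ≡ a ⊔ b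
nodeRank-≢ {a} {b} a≢b = cong (λ c → if c then suc a else a ⊔ b) (dec-false (a ℕ.≟ b) a≢b)

nodeRank-≤ : ∀ {a b c} → a ≤ c → b ≤ c → nodeRank a b ≤ suc c
nodeRank-≤ {a} {b} a≤c b≤c with a ℕ.≟ b
... | yes a≡b = ≤-trans (≤-reflexive (nodeRank-≡ a≡b)) (s≤s a≤c)
... | no a≢b = ≤-trans (≤-reflexive (nodeRank-≢ a≢b)) (m≤n⇒m≤1+n (⊔-lub a≤c b≤c))

nodeRank-<ˡ : ∀ {a b c} → a < c → b ≤ c → nodeRank a b ≤ c
nodeRank-<ˡ {a} {b} a<c b≤c with a ℕ.≟ b
... | yes a≡b = ≤-trans (≤-reflexive (nodeRank-≡ a≡b)) a<c
... | no a≢b = ≤-trans (≤-reflexive (nodeRank-≢ a≢b)) (⊔-lub (<⇒≤ a<c) b≤c)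

nodeRank-<ʳ : ∀ {a b c} → a ≤ c → b < c → nodeRank a b ≤ c
nodeRank-<ʳ {a} {b} a≤c b<c with a ℕ.≟ b
... | yes refl = ≤-trans (≤-reflexive (nodeRank-≡ refl)) b<c
... | no a≢b = ≤-trans (≤-reflexive (nodeRank-≢ a≢b)) (⊔-lub a≤c (<⇒≤ b<c))

≤-nodeRankˡ : ∀ a b → a ≤ nodeRank a b
≤-nodeRankˡ a b with a ℕ.≟ b
... | yes a≡b = ≤-trans (n≤1+n a) (≤-reflexive (sym (nodeRank-≡ a≡b)))
... | no a≢b = ≤-trans (m≤m⊔n a b) (≤-reflexive (sym (nodeRank-≢ a≢b)))

≤-nodeRankʳ : ∀ a b → b ≤ nodeRank a b
≤-nodeRankʳ a b with a ℕ.≟ b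
... | yes refl = ≤-trans (n≤1+n a) (≤-reflexive (sym (nodeRank-≡ refl)))
... | no a≢b = ≤-trans (m≤n⊔m a b) (≤-reflexive (sym (nodeRank-≢ a≢b)))

nodeRank-drops : ∀ a b → a < nodeRank a b ⊎ b < nodeRank a b
nodeRank-drops a b with a ℕ.≟ b | <-cmp a b
... | yes a≡b | _ = inj₁ (≤-trans (n<1+n a) (≤-reflexive (sym (nodeRank-≡ a≡b))))
... | no a≢b | tri< a<b _ _ = inj₁ (<-≤-trans a<b (≤-trans (m≤n⊔m a b) (≤-reflexive (sym (nodeRank-≢ a≢b)))))
... | no a≢b | tri≈ _ a≡b _ = contradiction a≡b a≢b
... | no a≢b | tri> _ _ b<a = inj₂ (<-≤-trans b<a (≤-trans (m≤m⊔n a b) (≤-reflexive (sym (nodeRank-≢ a≢b)))))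

positions : Subset n → List (Fin n)
positions [] = []
positions (true ∷ S) = Fin.zero ∷ map Fin.suc (positions S)
positions (false ∷ S) = map Fin.suc (positions S)

∈-positions : ∀ {S : Subset n} {j} → j ∈ S → j ∈ₗ positions S
∈-positions {S = true ∷ S} here = hereₗ refl
∈-positions {S = true ∷ S} (there j∈S) = thereₗ (∈-map⁺ Fin.suc (∈-positions j∈S))
∈-positions {S = false ∷ S} (there j∈S) = ∈-map⁺ Fin.suc (∈-positions j∈S)

length-positions : (S : Subset n) → length (positions S) ≡ ∣ S ∣
length-positions [] = refl
length-positions (true ∷ S) = cong suc (trans (length-map Fin.suc (positions S)) (length-positions S))
length-positions (false ∷ S) = trans (length-map Fin.suc (positions S)) (length-positions S)

query : List (Fin n) → Input n → (Input n → DTree n) → DTree n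
query [] w g = g w
query (p ∷ ps) w g = node p (query ps w (λ v → g (v [ p ]≔ false))) (query ps w (λ v → g (v [ p ]≔ true)))

copy : List (Fin n) → Input n → Input n → Input n
copy [] x w = w
copy (p ∷ ps) x w = copy ps x w [ p ]≔ lookup x p

lookup-copy : ∀ {ps : List (Fin n)} {j} x w → j ∈ₗ ps → lookup (copy ps x w) j ≡ lookup x j
lookup-copy {ps = p ∷ ps} x w (hereₗ refl) = lookup∘update p (copy ps x w) (lookup x p)
lookup-copy {ps = p ∷ ps} {j} x w (thereₗ j∈ps) with j ≟ᶠ p
... | yes refl = lookup∘update p (copy ps x w) (lookup x p)
... | no j≢p = trans (lookup∘update′ j≢p (copy ps x w) (lookup x p)) (lookup-copy x w j∈ps)

Agree-copy-positions : ∀ (S : Subset n) x w → Agree S (copy (positions S) x w) x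
Agree-copy-positions S x w j j∈S = lookup-copy x w (∈-positions j∈S)

eval-query : ∀ (ps : List (Fin n)) w g x → eval (query ps w g) x ≡ eval (g (copy ps x w)) x
eval-query [] w g x = refl
eval-query (p ∷ ps) w g x with lookup x p
... | true = eval-query ps w _ x
... | false = eval-query ps w _ x

rank-query-≤ : ∀ (ps : List (Fin n)) w g {B} → (∀ v → rank (g v) ≤ B) → rank (query ps w g) ≤ length ps + B
rank-query-≤ [] w g g≤B = g≤B w
rank-query-≤ (p ∷ ps) w g g≤B = nodeRank-≤ (rank-query-≤ ps w _ (g≤B ∘ _)) (rank-query-≤ ps w _ (g≤B ∘ _))

rank-query-< : ∀ (ps : List (Fin n)) w g x {B} → (∀ v → rank (g v) ≤ B) → rank (g (copy ps x w)) < B →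
               rank (query ps w g) < length ps + B
rank-query-< [] w g x g≤B g<B = g<B
rank-query-< (p ∷ ps) w g x g≤B g<B with lookup x p
... | true = s≤s (nodeRank-<ʳ (rank-query-≤ ps w _ (g≤B ∘ _)) (rank-query-< ps w _ x (g≤B ∘ _) g<B))
... | false = s≤s (nodeRank-<ˡ (rank-query-< ps w _ x (g≤B ∘ _) g<B) (rank-query-≤ ps w _ (g≤B ∘ _)))

m<n+o⇒m≤n∸1+o : ∀ n {m o} → m < n + o → m ≤ n ∸ 1 + o
m<n+o⇒m≤n∸1+o zero m<o = <⇒≤ m<o
m<n+o⇒m≤n∸1+o (suc n) (s≤s m≤n+o) = m≤n+o

rankBound-step : ∀ b {k m B} → 1 ≤ B →
                 (∀ (g : BoolFun n) → CertificateBound g (not b) k → CertificateBound g b m → RankBound g B) →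
                 ∀ (f : BoolFun n) → CertificateBound f (not b) (suc k) → CertificateBound f b m → RankBound f (m ∸ 1 + B)
rankBound-step {n} b {k} {m} {B} 1≤B induction f cb¬b cbb with ∃-input? (λ a → f a ≟ᴮ b)
... | no noInput = leaf (not b) , (λ x → sym (¬-not (λ fx≡b → noInput (x , fx≡b)))) , z≤n
... | yes (a , fa≡b) with cbb a fa≡b
... | S , cert , ∣S∣≤m = query ps a subtree , computes , m<n+o⇒m≤n∸1+o m rank<
  where
  ps = positions S

  subtree′ : ∀ w → Σ[ t ∈ DTree n ] Computes t (restrict S w f) × rank t ≤ B × (Agree S w a → rank t ≡ 0)
  subtree′ w with Agree? S w a
  ... | yes w≈a = leaf b , (λ x → sym (trans (restrict-constant cert w≈a x) fa≡b)) , z≤n , λ _ → refl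
  ... | no w≉a with induction (restrict S w f) (restrict-shrinks fa≡b cert cb¬b) (restrict-preserves cbb)
  ... | t , t-computes , rank≤B = t , t-computes , rank≤B , λ w≈a → contradiction w≈a w≉a

  subtree : Input n → DTree n
  subtree w = proj₁ (subtree′ w)

  computes : Computes (query ps a subtree) f
  computes x = begin
    eval (query ps a subtree) x        ≡⟨ eval-query ps a subtree x ⟩
    eval (subtree (copy ps x a)) x     ≡⟨ proj₁ (proj₂ (subtree′ (copy ps x a))) x ⟩
    f (merge S (copy ps x a) x)        ≡⟨ cong f (merge-identity (Agree-copy-positions S x a)) ⟩
    f x                                ∎
    where open ≡-Reasoning

  rank< : rank (query ps a subtree) < m + B
  rank< = begin-strict
    rank (query ps a subtree) <⟨ rank-query-< ps a subtree a (λ w → proj₁ (proj₂ (proj₂ (subtree′ w)))) leaf<B ⟩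
    length ps + B             ≡⟨ cong (_+ B) (length-positions S) ⟩
    ∣ S ∣ + B                 ≤⟨ +-monoˡ-≤ B ∣S∣≤m ⟩
    m + B                     ∎
    where
    open ≤-Reasoning
    leaf<B : rank (subtree (copy ps a a)) < B
    leaf<B = subst (_< B) (sym (proj₂ (proj₂ (proj₂ (subtree′ _))) (Agree-copy-positions S a a))) 1≤B

rankBound : ∀ k m (f : BoolFun n) → CertificateBound f false k → CertificateBound f true m →
            RankBound f ((k ∸ 1) * (m ∸ 1) + 1)
rankBound zero m f cb₀ cb₁ = CertificateBound-zero⇒RankBound _ cb₀
rankBound (suc zero) zero f cb₀ cb₁ = CertificateBound-zero⇒RankBound _ cb₁
rankBound (suc zero) (suc m) f cb₀ cb₁ =
  rankBound-step false ≤-refl (λ g cb₁′ cb₀′ → rankBound 1 m g cb₀′ cb₁′) f cb₁ cb₀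
rankBound (suc (suc k)) m f cb₀ cb₁ with rankBound-step true (m≤n+m 1 _) (rankBound (suc k) m) f cb₀ cb₁
... | t , t-computes , rank≤ = t , t-computes , ≤-trans rank≤ (≤-reflexive (sym (+-assoc (m ∸ 1) (k * (m ∸ 1)) 1)))

child : Bool → DTree n → DTree n → DTree n
child b t₀ t₁ = if b then t₁ else t₀

eval-node : ∀ i (t₀ t₁ : DTree n) x → eval (node i t₀ t₁) x ≡ eval (child (lookup x i) t₀ t₁) x
eval-node i t₀ t₁ x with lookup x i
... | true = refl
... | false = refl

rank-child-≤ : ∀ b i (t₀ t₁ : DTree n) → rank (child b t₀ t₁) ≤ rank (node i t₀ t₁)
rank-child-≤ true i t₀ t₁ = ≤-nodeRankʳ (rank t₀) (rank t₁)
rank-child-≤ false i t₀ t₁ = ≤-nodeRankˡ (rank t₀) (rank t₁)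

rank-child-< : ∀ i (t₀ t₁ : DTree n) → ∃ λ b → rank (child b t₀ t₁) < rank (node i t₀ t₁)
rank-child-< i t₀ t₁ with nodeRank-drops (rank t₀) (rank t₁)
... | inj₁ t₀-drops = false , t₀-drops
... | inj₂ t₁-drops = true , t₁-drops

eval-node-agree : ∀ {i} {t₀ t₁ : DTree n} {a x b} → lookup a i ≡ b → lookup x i ≡ b →
                  eval (child b t₀ t₁) x ≡ eval (child b t₀ t₁) a → eval (node i t₀ t₁) x ≡ eval (node i t₀ t₁) a
eval-node-agree {i = i} {t₀} {t₁} {a} {x} refl xᵢ≡aᵢ eq =
  trans (eval-node i t₀ t₁ x) (trans (cong (λ c → eval (child c t₀ t₁) x) xᵢ≡aᵢ) (trans eq (sym (eval-node i t₀ t₁ a))))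

-- The coordinates in D are already fixed to their values in z; S collects the coordinates queried
-- along the path that always moves to a child of smaller rank at unfixed coordinates.
PathCertificate : DTree n → Subset n → Input n → Set
PathCertificate {n} t D z = Σ[ a ∈ Input n ] Σ[ S ∈ Subset n ]
  Agree D z a × ∣ S ∣ ≤ rank t × (∀ x → Agree D a x → Agree S a x → eval t x ≡ eval t a)

pathCertificate-node : ∀ i (t₀ t₁ : DTree n) → (∀ b D z → PathCertificate (child b t₀ t₁) D z) →
                       ∀ D z → PathCertificate (node i t₀ t₁) D z
pathCertificate-node i t₀ t₁ ih D z with i ∈? D
... | yes i∈D with ih (lookup z i) D z
... | a , S , z≈a , ∣S∣≤ , cert =
  a , S , z≈a , ≤-trans ∣S∣≤ (rank-child-≤ (lookup z i) i t₀ t₁) ,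
  λ x a≈x a≈ₛx → eval-node-agree (sym (z≈a i i∈D)) (trans (sym (a≈x i i∈D)) (sym (z≈a i i∈D))) (cert x a≈x a≈ₛx)
pathCertificate-node i t₀ t₁ ih D z | no i∉D with rank-child-< i t₀ t₁
... | b , child< with ih b (insert i D) (z [ i ]≔ b)
... | a , S , z′≈a , ∣S∣≤ , cert =
  a , insert i S , z≈a , ≤-trans (∣insert∣≤ i S) (≤-trans (s≤s ∣S∣≤) child<) , certificate
  where
  aᵢ≡b : lookup a i ≡ b
  aᵢ≡b = trans (sym (proj₁ (Agree-insert⁻ (z [ i ]≔ b) a z′≈a))) (lookup∘update i z b)

  z≈a : Agree D z a
  z≈a j j∈D = trans (sym (lookup∘update′ (λ { refl → i∉D j∈D }) z b)) (proj₂ (Agree-insert⁻ (z [ i ]≔ b) a z′≈a) j j∈D)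

  certificate : ∀ x → Agree D a x → Agree (insert i S) a x → eval (node i t₀ t₁) x ≡ eval (node i t₀ t₁) a
  certificate x a≈x a≈ₛx with Agree-insert⁻ a x a≈ₛx
  ... | aᵢ≡xᵢ , a≈ₛ′x = eval-node-agree aᵢ≡b (trans (sym aᵢ≡xᵢ) aᵢ≡b) (cert x (Agree-insert⁺ a x aᵢ≡xᵢ a≈x) a≈ₛ′x)

pathCertificate : (t : DTree n) → ∀ D z → PathCertificate t D z
pathCertificate {n} (leaf b) D z = z , empty , (λ _ _ → refl) , ≤-reflexive (∣⊥∣≡0 n) , λ _ _ _ → refl
pathCertificate (node i t₀ t₁) = pathCertificate-node i t₀ t₁ λ { true → pathCertificate t₁ ; false → pathCertificate t₀ }

rank-certificate : (t : DTree n) → Σ[ a ∈ Input n ] Σ[ S ∈ Subset n ] Certificate (eval t) a S × ∣ S ∣ ≤ rank t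
rank-certificate {n} t with pathCertificate t empty (replicate n false)
... | a , S , _ , ∣S∣≤ , cert = a , S , (λ x → cert x (λ _ j∈∅ → contradiction j∈∅ ∉⊥)) , ∣S∣≤

does-≡ : ∀ {x y : Bool} → does (x ≟ᴮ y) ≡ true → x ≡ y
does-≡ {x} {y} e with x ≟ᴮ y
... | yes x≡y = x≡y

agreeOn⇒Agree : ∀ (S : Subset n) a b → agreeOn S a b ≡ true → Agree S a b
agreeOn⇒Agree (s ∷ S) (x ∷ a) (y ∷ b) e Fin.zero here = does-≡ (∧-conicalˡ _ _ e)
agreeOn⇒Agree (s ∷ S) (x ∷ a) (y ∷ b) e (Fin.suc j) (there j∈S) = agreeOn⇒Agree S a b (∧-conicalʳ _ _ e) j j∈S

Agree⇒agreeOn : ∀ (S : Subset n) a b → Agree S a b → agreeOn S a b ≡ true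
Agree⇒agreeOn [] [] [] _ = refl
Agree⇒agreeOn (true ∷ S) (x ∷ a) (y ∷ b) ag =
  cong₂ _∧_ (dec-true (x ≟ᴮ y) (ag Fin.zero here)) (Agree⇒agreeOn S a b (λ j → ag (Fin.suc j) ∘ there))
Agree⇒agreeOn (false ∷ S) (x ∷ a) (y ∷ b) ag = Agree⇒agreeOn S a b (λ j → ag (Fin.suc j) ∘ there)

allB-≡-true⁺ : ∀ {A : Set} (p : A → Bool) xs → (∀ x → p x ≡ true) → allB p xs ≡ true
allB-≡-true⁺ p [] px = refl
allB-≡-true⁺ p (x ∷ xs) px = cong₂ _∧_ (px x) (allB-≡-true⁺ p xs px)

allB-≡-true⁻ : ∀ {A : Set} (p : A → Bool) {xs x} → allB p xs ≡ true → x ∈ₗ xs → p x ≡ true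
allB-≡-true⁻ p e (hereₗ refl) = ∧-conicalˡ _ _ e
allB-≡-true⁻ p e (thereₗ x∈xs) = allB-≡-true⁻ p (∧-conicalʳ _ _ e) x∈xs

isCertificate⇒Certificate : ∀ (f : BoolFun n) a S → isCertificate f a S ≡ true → Certificate f a S
isCertificate⇒Certificate f a S e x ag =
  does-≡ (subst (λ c → not c ∨ does (f x ≟ᴮ f a) ≡ true) (Agree⇒agreeOn S a x ag) (allB-≡-true⁻ _ e (∈-allVecs x)))

Certificate⇒isCertificate : ∀ (f : BoolFun n) a S → Certificate f a S → isCertificate f a S ≡ true
Certificate⇒isCertificate {n} f a S cert = allB-≡-true⁺ _ (allVecs n) implication
  where
  implication : ∀ x → not (agreeOn S a x) ∨ does (f x ≟ᴮ f a) ≡ true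
  implication x with agreeOn S a x in e
  ... | false = refl
  ... | true = dec-true (f x ≟ᴮ f a) (cert x (agreeOn⇒Agree S a x e))

⊓-preserves : ∀ {P : ℕ → Set} {x y} → P x → P y → P (x ⊓ y)
⊓-preserves {P = P} {x} {y} px py with ⊓-sel x y
... | inj₁ x⊓y≡x = subst P (sym x⊓y≡x) px
... | inj₂ x⊓y≡y = subst P (sym x⊓y≡y) py

foldr-⊓-≤ : ∀ e {xs x} → x ∈ₗ xs → foldr _⊓_ e xs ≤ x
foldr-⊓-≤ e {xs} {x} x∈xs =
  foldr-preservesᵒ {P = _≤ x} (λ a b → [ m≤n⇒m⊓o≤n b , m≤n⇒o⊓m≤n a ]) e xs (inj₂ (Any.map (λ { refl → ≤-refl }) x∈xs))

≤-foldr-⊔ : ∀ e {xs x} → x ∈ₗ xs → x ≤ foldr _⊔_ e xs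
≤-foldr-⊔ e {xs} {x} x∈xs =
  foldr-preservesᵒ {P = x ≤_} (λ a b → [ m≤n⇒m≤n⊔o b , m≤n⇒m≤o⊔n a ]) e xs (inj₂ (Any.map (λ { refl → ≤-refl }) x∈xs))

Cat-certificate : ∀ (f : BoolFun n) a → Σ[ S ∈ Subset n ] Certificate f a S × ∣ S ∣ ≤ Cat f a
Cat-certificate {n} f a =
  foldr-preservesᵇ {P = HasCertificate≤} (⊓-preserves {P = HasCertificate≤})
    (full , (λ x ag → cong f (sym (Agree-full⇒≡ ag))) , ≤-reflexive (∣⊤∣≡n n))
    (All-map⁺ (All.map (λ {S} isCert → S , isCertificate⇒Certificate f a S isCert , ≤-refl) (all-filter _ (allVecs n))))
  where
  HasCertificate≤ : ℕ → Set
  HasCertificate≤ k = Σ[ S ∈ Subset n ] Certificate f a S × ∣ S ∣ ≤ k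

Cat-minimal : ∀ (f : BoolFun n) a S → Certificate f a S → Cat f a ≤ ∣ S ∣
Cat-minimal {n} f a S cert =
  foldr-⊓-≤ n (∈-map⁺ ∣_∣ (∈-filter⁺ (λ S → isCertificate f a S ≟ᴮ true) (∈-allVecs S) (Certificate⇒isCertificate f a S cert)))

Cat≤Cb : ∀ (f : BoolFun n) {a b} → f a ≡ b → Cat f a ≤ Cb f b
Cat≤Cb {n} f {a} {b} fa≡b = ≤-foldr-⊔ 0 (∈-map⁺ (Cat f) (∈-filter⁺ (λ a → f a ≟ᴮ b) (∈-allVecs a) fa≡b))

Cmin≤Cat : ∀ (f : BoolFun n) a → Cmin f ≤ Cat f a
Cmin≤Cat {n} f a = foldr-⊓-≤ n (∈-map⁺ (Cat f) (∈-allVecs a))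

CertificateBound-Cb : ∀ (f : BoolFun n) b → CertificateBound f b (Cb f b)
CertificateBound-Cb f b a fa≡b with Cat-certificate f a
... | S , cert , ∣S∣≤ = S , cert , ≤-trans ∣S∣≤ (Cat≤Cb f fa≡b)

∸1*∸1≤⊔∸1^2 : ∀ a b → (a ∸ 1) * (b ∸ 1) ≤ (a ⊔ b ∸ 1) ^ 2
∸1*∸1≤⊔∸1^2 a b = begin
  (a ∸ 1) * (b ∸ 1)                ≤⟨ *-mono-≤ (∸-monoˡ-≤ 1 (m≤m⊔n a b)) (∸-monoˡ-≤ 1 (m≤n⊔m a b)) ⟩
  (a ⊔ b ∸ 1) * (a ⊔ b ∸ 1)        ≡⟨ cong ((a ⊔ b ∸ 1) *_) (sym (^-identityʳ (a ⊔ b ∸ 1))) ⟩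
  (a ⊔ b ∸ 1) ^ 2                  ∎
  where open ≤-Reasoning

theorem5p8 : ∀ (n : ℕ) (f : BoolFun n) (r : ℕ) → IsRank f r →
    Cmin f ≤ r ×
    r ≤ (C₀ f ∸ 1) * (C₁ f ∸ 1) + 1 ×
    (C₀ f ∸ 1) * (C₁ f ∸ 1) + 1 ≤ (C f ∸ 1) ^ 2 + 1
theorem5p8 n f r ((t , t-computes , rank≡r) , minimal) = Cmin≤r , r≤bound , +-monoˡ-≤ 1 (∸1*∸1≤⊔∸1^2 (C₀ f) (C₁ f))
  where
  Cmin≤r : Cmin f ≤ r
  Cmin≤r with rank-certificate t
  ... | a , S , cert , ∣S∣≤ = begin
    Cmin f     ≤⟨ Cmin≤Cat f a ⟩
    Cat f a    ≤⟨ Cat-minimal f a S (λ x ag → trans (sym (t-computes x)) (trans (cert x ag) (t-computes a))) ⟩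
    ∣ S ∣      ≤⟨ ∣S∣≤ ⟩
    rank t     ≡⟨ rank≡r ⟩
    r          ∎
    where open ≤-Reasoning

  r≤bound : r ≤ (C₀ f ∸ 1) * (C₁ f ∸ 1) + 1
  r≤bound with rankBound (C₀ f) (C₁ f) f (CertificateBound-Cb f false) (CertificateBound-Cb f true)
  ... | t′ , t′-computes , rank≤ = ≤-trans (minimal t′ t′-computes) rank≤
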